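{- There is a one-to-one correspondence, preserving groundedness and reachability, between assembly spaces and acyclic subhypergraphs of B-hypergraphs in which every hyperedge $(E^-,E^+)$ satisfies $|E^-|=2$. Under this correspondence an assembly space with vertex set $V$ corresponds to the B-hypergraph on $V$ that has a hyperedge $(\{x,y\},\{z\})$ (the tail being the multiset $\{x,x\}$ when $x=y$) if and only if the assembly space has an edge from $x$ to $z$ with label $y$.
   Context: A directed multigraph (quiver) $\Gamma=(V,Q,h^-,h^+)$ has vertex set $V$, edge set $Q$, and maps $h^-,h^+:Q\to V$ giving the tail and head of each edge. A path is a sequence $(x_0,e_1,x_1,\dots,e_n,x_n)$ with $h^-(e_i)=x_{i-1}$ and $h^+(e_i)=x_i$; $(x_0)$ is a path of length $0$. We write $x\le y$ (reachability) if there is a path from $x$ to $y$. A cycle is a path of length $n\ge1$ with $x_0=x_n$, and $\Gamma$ is acyclic if it has no cycle. A vertex $x$ is minimal if there is no $z\neq x$ with $z\le x$; $\min V$ denotes the set of minimal vertices. $\Gamma$ is grounded if for every $x\in V$ there is $z\in\min V$ with $z\le x$. An assembly space is a grounded acyclic directed multigraph with finite $\min V$, together with an edge labeling $\varphi:Q\to V$ such that for every edge $a$ from $x$ to $z$ with $\varphi(a)=y$ there is an edge $b$ from $y$ to $z$ with $\varphi(b)=x$. A directed (multi)hypergraph $\mathscr{H}=(V,\mathcal{E})$ has vertex set $V$ and a (multi)set $\mathcal{E}$ of hyperedges $(E^-,E^+)$, where $E^-$ (tail) and $E^+$ (head) are multisets of elements of $V$; $|A|$ is the sum of multiplicities of a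 multiset $A$. A hyperpath is a sequence $(x_0,E_1,x_1,\dots,E_n,x_n)$ with $x_{i-1}\in E_i^-$ and $x_i\in E_i^+$ for $1\le i\le n$. It is cyclic if $x_n\in E_1^-$, and $\mathscr{H}$ is acyclic if it has no cyclic hyperpath. Reachability: $y\le x$ if $x=y$ or there is a hyperpath of length $n\ge1$ from $y$ to $x$; minimal vertices and groundedness are defined from this relation as for quivers. A subhypergraph $(V',\mathcal{E}')$ of $\mathscr{H}$ has $V'\subseteq V$ and $\mathcal{E}'\subseteq\mathcal{E}$. $\mathscr{H}$ is a B-hypergraph if $|E^+|=1$ for every hyperedge. -}

module Defs where

open import Data.Nat using (ℕ; zero; suc)
open import Data.List using (List; []; _∷_; length)
open import Data.List.Membership.Propositional using (_∈_)
open import Data.List.Relation.Binary.Permutation.Propositional using (_↭_)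
open import Data.Product using (Σ; Σ-syntax; _×_)
open import Relation.Binary.PropositionalEquality using (_≡_)
open import Relation.Nullary using (¬_)
open import Function.Bundles using (_⇔_)

module _ {V : Set} (_≼_ : V → V → Set) where
  IsMinimal : V → Set
  IsMinimal x = ∀ z → z ≼ x → z ≡ x

  IsGrounded : Set
  IsGrounded = ∀ x → Σ[ z ∈ V ] (IsMinimal z × z ≼ x)

  FiniteMin : Set
  FiniteMin = Σ[ l ∈ List V ] (∀ x → IsMinimal x → x ∈ l)

record LQuiver (V : Set) : Set₁ where
  field
    Q   : Set
    src : Q → V
    tgt : Q → V
    lab : Q → V

module _ {V : Set} (Γ : LQuiver V) where
  open LQuiver Γ

  data QPath : V → V → ℕ → Set where
    qnil  : ∀ x → QPath x x zero
    qcons : ∀ {x y n} (a : Q) → src a ≡ x → QPath (tgt a) y n → QPath x y (suc n)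

  QReach : V → V → Set
  QReach x y = Σ[ n ∈ ℕ ] QPath x y n

  QAcyclic : Set
  QAcyclic = ¬ (Σ[ x ∈ V ] Σ[ n ∈ ℕ ] QPath x x (suc n))

  LabelAxiom : Set
  LabelAxiom = ∀ (a : Q) → Σ[ b ∈ Q ] (src b ≡ lab a × tgt b ≡ tgt a × lab b ≡ src a)

  EdgeRel : V → V → V → Set
  EdgeRel x y z = Σ[ a ∈ Q ] (src a ≡ x × lab a ≡ y × tgt a ≡ z)

record AssemblySpace (V : Set) : Set₁ where
  field
    quiver   : LQuiver V
    acyclic  : QAcyclic quiver
    grounded : IsGrounded (QReach quiver)
    finMin   : FiniteMin (QReach quiver)
    axiom    : LabelAxiom quiver

-- Directed multi-hypergraphs on V; multisets are lists (up to _↭_)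

record Hypergraph (V : Set) : Set₁ where
  field
    E    : Set
    tail : E → List V
    head : E → List V

module _ {V : Set} (H : Hypergraph V) where
  open Hypergraph H

  IsBHypergraph : Set
  IsBHypergraph = ∀ e → length (head e) ≡ 1

  TailsOfSize2 : Set
  TailsOfSize2 = ∀ e → length (tail e) ≡ 2

  data HPath : V → V → ℕ → Set where
    hnil  : ∀ x → HPath x x zero
    hcons : ∀ {x y z n} (e : E) → x ∈ tail e → y ∈ head e → HPath y z n → HPath x z (suc n)

  HReach : V → V → Set
  HReach x y = Σ[ n ∈ ℕ ] HPath x y n

  CyclicHyperpath : Set
  CyclicHyperpath =
    Σ[ e ∈ E ] Σ[ x₀ ∈ V ] Σ[ x₁ ∈ V ] Σ[ xₙ ∈ V ] Σ[ n ∈ ℕ ]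
      (x₀ ∈ tail e × x₁ ∈ head e × HPath x₁ xₙ n × xₙ ∈ tail e)

  HAcyclic : Set
  HAcyclic = ¬ CyclicHyperpath

  HEdgeRel : V → V → V → Set
  HEdgeRel x y z = Σ[ e ∈ E ] (tail e ↭ (x ∷ y ∷ []) × head e ↭ (z ∷ []))

Corresponds : {V : Set} → LQuiver V → Hypergraph V → Set
Corresponds Γ H = ∀ x y z → HEdgeRel H x y z ⇔ EdgeRel Γ x y z

{-# OPTIONS --safe #-}
module Submission where

-- An edge x → z labelled y orders the pair {x, y}, a hyperedge ({x, y}, {z}) does not.
-- The label axiom says precisely that edges come in pairs (x, y, z), (y, x, z), i.e. that the
-- edge relation is symmetric in x and y like the hyperedge relation; so each structure determines
-- the other. When tails have size 2 and heads size 1, a hyperpath step from x to z is the same as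
-- an edge from x to z, so paths, reachability, cycles, minimal vertices and groundedness coincide.

open import Defs
open import Data.Nat using (ℕ; suc)
open import Data.List using (List; []; _∷_; length)
open import Data.List.Membership.Propositional using (_∈_)
open import Data.List.Relation.Unary.Any using (here; there)
open import Data.List.Relation.Binary.Permutation.Propositional
  using (_↭_; ↭-refl; ↭-sym; ↭-trans; ↭-swap)
open import Data.List.Relation.Binary.Permutation.Propositional.Properties
  using (∈-resp-↭; drop-∷; ↭-singleton-inv)
open import Data.Product using (Σ-syntax; ∃-syntax; _×_; _,_)
open import Data.Sum using (_⊎_; inj₁; inj₂)
open import Relation.Binary.PropositionalEquality using (_≡_; refl)
open import Function.Bundles using (_⇔_; mk⇔; Equivalence)
open import Function.Properties.Equivalence using () renaming (sym to ⇔-sym; trans to ⇔-trans)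
open import Function.Related.TypeIsomorphisms using (¬-cong-⇔)

open Equivalence using (to; from)

module _ {V : Set} where

  ↭-pair-inv : {a b x y : V} → a ∷ b ∷ [] ↭ x ∷ y ∷ [] → (a ≡ x × b ≡ y) ⊎ (a ≡ y × b ≡ x)
  ↭-pair-inv {x = x} {y} p with ∈-resp-↭ p (here refl)
  ... | here refl
        with refl ← ↭-singleton-inv (drop-∷ p) = inj₁ (refl , refl)
  ... | there (here refl)
        with refl ← ↭-singleton-inv (drop-∷ (↭-trans p (↭-swap x y ↭-refl))) = inj₂ (refl , refl)

  ∈-pair⇒↭ : {x : V} (l : List V) → length l ≡ 2 → x ∈ l → ∃[ w ] l ↭ x ∷ w ∷ []
  ∈-pair⇒↭ (a ∷ b ∷ []) refl (here refl)        = b , ↭-refl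
  ∈-pair⇒↭ (a ∷ b ∷ []) refl (there (here refl)) = a , ↭-swap a b ↭-refl

  ∈-singleton⇒↭ : {x : V} (l : List V) → length l ≡ 1 → x ∈ l → l ↭ x ∷ []
  ∈-singleton⇒↭ (a ∷ []) refl (here refl) = ↭-refl

  ∈-↭-head : {x : V} {l xs : List V} → l ↭ x ∷ xs → x ∈ l
  ∈-↭-head l↭ = ∈-resp-↭ (↭-sym l↭) (here refl)

  module _ {R S : V → V → Set} (R⇔S : ∀ x y → R x y ⇔ S x y) where

    IsMinimal-resp : {x : V} → IsMinimal R x → IsMinimal S x
    IsMinimal-resp min z Szx = min z (from (R⇔S z _) Szx)

    IsGrounded-resp : IsGrounded R → IsGrounded S
    IsGrounded-resp grounded x with grounded x
    ... | z , min , Rzx = z , IsMinimal-resp min , to (R⇔S z x) Rzx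

  FiniteMin-resp : {R S : V → V → Set} → (∀ x y → R x y ⇔ S x y) → FiniteMin R → FiniteMin S
  FiniteMin-resp R⇔S (l , complete) =
    l , λ x min → complete x (IsMinimal-resp (λ u v → ⇔-sym (R⇔S u v)) min)

  ClosedHPath : Hypergraph V → Set
  ClosedHPath H = Σ[ x ∈ V ] Σ[ n ∈ ℕ ] HPath H x x (suc n)

  -- A cyclic hyperpath (x₀, E₁, x₁, …, xₙ) closes up to the hyperpath (xₙ, E₁, x₁, …, xₙ).
  CyclicHyperpath⇔ClosedHPath : (H : Hypergraph V) → CyclicHyperpath H ⇔ ClosedHPath H
  CyclicHyperpath⇔ClosedHPath H = mk⇔ close cut
    where
    close : CyclicHyperpath H → ClosedHPath H
    close (e , _ , _ , xₙ , n , _ , x₁∈ , p , xₙ∈) = xₙ , n , hcons e xₙ∈ x₁∈ p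
    cut : ClosedHPath H → CyclicHyperpath H
    cut (x , n , hcons e x∈ y∈ p) = e , x , _ , x , n , x∈ , y∈ , p , x∈

  ClosedQPath : LQuiver V → Set
  ClosedQPath Γ = Σ[ x ∈ V ] Σ[ n ∈ ℕ ] QPath Γ x x (suc n)

  toHypergraph : LQuiver V → Hypergraph V
  toHypergraph Γ = record
    { E    = Q
    ; tail = λ a → src a ∷ lab a ∷ []
    ; head = λ a → tgt a ∷ []
    }
    where open LQuiver Γ

  toHypergraph-isB : (Γ : LQuiver V) → IsBHypergraph (toHypergraph Γ)
  toHypergraph-isB Γ _ = refl

  toHypergraph-tailsOfSize2 : (Γ : LQuiver V) → TailsOfSize2 (toHypergraph Γ)
  toHypergraph-tailsOfSize2 Γ _ = refl

  toHypergraph-corresponds : (Γ : LQuiver V) → LabelAxiom Γ → Corresponds Γ (toHypergraph Γ)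
  toHypergraph-corresponds Γ axiom x y z = mk⇔ hyperedge⇒edge edge⇒hyperedge
    where
    open LQuiver Γ
    hyperedge⇒edge : HEdgeRel (toHypergraph Γ) x y z → EdgeRel Γ x y z
    hyperedge⇒edge (a , tail↭ , head↭) with refl ← ↭-singleton-inv (↭-sym head↭) | ↭-pair-inv tail↭
    ... | inj₁ (refl , refl) = a , refl , refl , refl
    ... | inj₂ (refl , refl) with b , src-b , tgt-b , lab-b ← axiom a = b , src-b , lab-b , tgt-b
    edge⇒hyperedge : EdgeRel Γ x y z → HEdgeRel (toHypergraph Γ) x y z
    edge⇒hyperedge (a , refl , refl , refl) = a , ↭-refl , ↭-refl

  -- An edge is a hyperedge together with an ordering (x, y) of its tail.
  toQuiver : Hypergraph V → LQuiver V
  toQuiver H = record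
    { Q   = Σ[ x ∈ V ] Σ[ y ∈ V ] Σ[ z ∈ V ] HEdgeRel H x y z
    ; src = λ { (x , _ , _ , _) → x }
    ; tgt = λ { (_ , _ , z , _) → z }
    ; lab = λ { (_ , y , _ , _) → y }
    }

  toQuiver-labelAxiom : (H : Hypergraph V) → LabelAxiom (toQuiver H)
  toQuiver-labelAxiom H (x , y , z , e , tail↭ , head↭) =
    (y , x , z , e , ↭-trans tail↭ (↭-swap x y ↭-refl) , head↭) , refl , refl , refl

  toQuiver-corresponds : (H : Hypergraph V) → Corresponds (toQuiver H) H
  toQuiver-corresponds H x y z = mk⇔ (λ h → (x , y , z , h) , refl , refl , refl) hyperedge
    where
    hyperedge : EdgeRel (toQuiver H) x y z → HEdgeRel H x y z
    hyperedge ((_ , _ , _ , h) , refl , refl , refl) = h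

  module _ {Γ : LQuiver V} {H : Hypergraph V}
           (isB : IsBHypergraph H) (size2 : TailsOfSize2 H) (Γ~H : Corresponds Γ H) where
    open LQuiver Γ
    open Hypergraph H

    edge⇒hyperedge : (a : Q) → Σ[ e ∈ E ] (src a ∈ tail e × tgt a ∈ head e)
    edge⇒hyperedge a with e , tail↭ , head↭ ← from (Γ~H _ _ _) (a , refl , refl , refl) =
      e , ∈-↭-head tail↭ , ∈-↭-head head↭

    hyperedge⇒edge : {x y : V} (e : E) → x ∈ tail e → y ∈ head e → Σ[ a ∈ Q ] (src a ≡ x × tgt a ≡ y)
    hyperedge⇒edge e x∈ y∈
      with w , tail↭ ← ∈-pair⇒↭ (tail e) (size2 e) x∈
      with a , src-a , _ , tgt-a ← to (Γ~H _ w _) (e , tail↭ , ∈-singleton⇒↭ (head e) (isB e) y∈)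
      = a , src-a , tgt-a

    QPath⇒HPath : {x y : V} {n : ℕ} → QPath Γ x y n → HPath H x y n
    QPath⇒HPath (qnil x) = hnil x
    QPath⇒HPath (qcons a refl p) with e , src∈ , tgt∈ ← edge⇒hyperedge a =
      hcons e src∈ tgt∈ (QPath⇒HPath p)

    HPath⇒QPath : {x y : V} {n : ℕ} → HPath H x y n → QPath Γ x y n
    HPath⇒QPath (hnil x) = qnil x
    HPath⇒QPath (hcons e x∈ y∈ p) with a , src-a , refl ← hyperedge⇒edge e x∈ y∈ =
      qcons a src-a (HPath⇒QPath p)

    QReach⇔HReach : ∀ x y → QReach Γ x y ⇔ HReach H x y
    QReach⇔HReach x y =
      mk⇔ (λ (n , p) → n , QPath⇒HPath p) (λ (n , p) → n , HPath⇒QPath p)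

    QAcyclic⇔HAcyclic : QAcyclic Γ ⇔ HAcyclic H
    QAcyclic⇔HAcyclic = ¬-cong-⇔ (⇔-trans closed⇔closed (⇔-sym (CyclicHyperpath⇔ClosedHPath H)))
      where
      closed⇔closed : ClosedQPath Γ ⇔ ClosedHPath H
      closed⇔closed = mk⇔ (λ (x , n , p) → x , n , QPath⇒HPath p)
                          (λ (x , n , p) → x , n , HPath⇒QPath p)

    QGrounded⇔HGrounded : IsGrounded (QReach Γ) ⇔ IsGrounded (HReach H)
    QGrounded⇔HGrounded = mk⇔ (IsGrounded-resp QReach⇔HReach)
                               (IsGrounded-resp (λ x y → ⇔-sym (QReach⇔HReach x y)))

  toHypergraph-acyclic : (A : AssemblySpace V) → HAcyclic (toHypergraph (AssemblySpace.quiver A))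
  toHypergraph-acyclic A =
    to (QAcyclic⇔HAcyclic (toHypergraph-isB quiver) (toHypergraph-tailsOfSize2 quiver)
                          (toHypergraph-corresponds quiver axiom))
       acyclic
    where open AssemblySpace A

  toAssemblySpace : (H : Hypergraph V) → IsBHypergraph H → TailsOfSize2 H → HAcyclic H →
    IsGrounded (HReach H) → FiniteMin (HReach H) → AssemblySpace V
  toAssemblySpace H isB size2 acyclic grounded finMin = record
    { quiver   = toQuiver H
    ; acyclic  = from (QAcyclic⇔HAcyclic isB size2 Γ~H) acyclic
    ; grounded = from (QGrounded⇔HGrounded isB size2 Γ~H) grounded
    ; finMin   = FiniteMin-resp (λ x y → ⇔-sym (QReach⇔HReach isB size2 Γ~H x y)) finMin
    ; axiom    = toQuiver-labelAxiom H
    }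
    where Γ~H = toQuiver-corresponds H

mainTheorem1 : (V : Set) →
      -- every edge-labelled quiver satisfying the assembly axiom has a corresponding B-hypergraph with |E⁻| = 2
      ((Γ : LQuiver V) → LabelAxiom Γ →
        Σ[ H ∈ Hypergraph V ] (IsBHypergraph H × TailsOfSize2 H × Corresponds Γ H))
    × -- every B-hypergraph with |E⁻| = 2 has a corresponding labelled quiver satisfying the assembly axiom
      ((H : Hypergraph V) → IsBHypergraph H → TailsOfSize2 H →
        Σ[ Γ ∈ LQuiver V ] (LabelAxiom Γ × Corresponds Γ H))
    × -- the correspondence is one-to-one (on the edge / hyperedge relations)
      ((Γ Γ' : LQuiver V) (H : Hypergraph V) → Corresponds Γ H → Corresponds Γ' H →
        ∀ x y z → EdgeRel Γ x y z ⇔ EdgeRel Γ' x y z)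
    × ((Γ : LQuiver V) (H H' : Hypergraph V) → Corresponds Γ H → Corresponds Γ H' →
        ∀ x y z → HEdgeRel H x y z ⇔ HEdgeRel H' x y z)
    × -- it preserves reachability, acyclicity and groundedness
      ((Γ : LQuiver V) (H : Hypergraph V) → LabelAxiom Γ → IsBHypergraph H → TailsOfSize2 H →
        Corresponds Γ H →
        (∀ x y → QReach Γ x y ⇔ HReach H x y)
        × (QAcyclic Γ ⇔ HAcyclic H)
        × (IsGrounded (QReach Γ) ⇔ IsGrounded (HReach H)))
    × -- in particular: assembly spaces ↦ acyclic B-hypergraphs with |E⁻| = 2
      ((A : AssemblySpace V) →
        Σ[ H ∈ Hypergraph V ] (IsBHypergraph H × TailsOfSize2 H × HAcyclic H
          × Corresponds (AssemblySpace.quiver A) H))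
    × -- and grounded acyclic B-hypergraphs (|E⁻| = 2, finitely many minimal vertices) ↦ assembly spaces
      ((H : Hypergraph V) → IsBHypergraph H → TailsOfSize2 H → HAcyclic H →
        IsGrounded (HReach H) → FiniteMin (HReach H) →
        Σ[ A ∈ AssemblySpace V ] Corresponds (AssemblySpace.quiver A) H)
mainTheorem1 V =
    (λ Γ axiom → toHypergraph Γ , toHypergraph-isB Γ , toHypergraph-tailsOfSize2 Γ
               , toHypergraph-corresponds Γ axiom)
  , (λ H _ _ → toQuiver H , toQuiver-labelAxiom H , toQuiver-corresponds H)
  , (λ _ _ _ Γ~H Γ'~H x y z → ⇔-trans (⇔-sym (Γ~H x y z)) (Γ'~H x y z))
  , (λ _ _ _ Γ~H Γ~H' x y z → ⇔-trans (Γ~H x y z) (⇔-sym (Γ~H' x y z)))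
  , (λ _ _ _ isB size2 Γ~H → QReach⇔HReach isB size2 Γ~H
                           , QAcyclic⇔HAcyclic isB size2 Γ~H
                           , QGrounded⇔HGrounded isB size2 Γ~H)
  , (λ A → let open AssemblySpace A in
       toHypergraph quiver , toHypergraph-isB quiver , toHypergraph-tailsOfSize2 quiver
     , toHypergraph-acyclic A , toHypergraph-corresponds quiver axiom)
  , (λ H isB size2 acyclic grounded finMin →
       toAssemblySpace H isB size2 acyclic grounded finMin , toQuiver-corresponds H)
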